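{- The following rule is admissible in $\mathsf{LLM}$: from $\vDash\Upsilon:\Sigma,[P]$ infer $\vDash\Upsilon:\lfloor\Sigma\rfloor,[P]$. Furthermore, it is strongly admissible, in the sense that applying the rule does not change the shape of the resulting derivation.
   Context: $\mathsf{LLM}$ is a multifocused sequent calculus for full linear logic over a polarised syntax. Positive formulas: $P,Q ::= a \mid 1 \mid P\otimes Q \mid 0 \mid P\oplus Q \mid\ !N \mid\ \downarrow N$. Negative formulas: $N,M ::= a^\perp \mid \bot \mid N \mathbin{⅋} M \mid \top \mid N \mathbin{\&} M \mid\ ?P \mid\ \uparrow P$ ($\downarrow,\uparrow$ are polarity shifts). $\Gamma$ ranges over multisets of negative formulas; $\Psi$ over multisets of negatives and focused positives $[P]$; $\Upsilon$ (persistent context) over multisets of positives. Sequents: $\vdash\Upsilon:\Gamma$ (inversion) and $\vDash\Upsilon:\Psi$ (focusing). The $\downarrow$ rule: from $\vdash\Upsilon:\Gamma,\Delta$ infer $\vDash\Upsilon:\Gamma,[\downarrow\Delta]$ ($\Delta$ non-empty, all foci blurred at once); the other focused rules are axiom $\vDash\Upsilon:a^\perp,[a]$, $1$, $\otimes$ (splitting the context), $\oplus_L,\oplus_R$, and $!$ (from $\vdash\Upsilon:N$ infer $\vDash\Upsilon:[!N]$); the decision rule from $\vDash\Upsilon:[\Upsilon^{\vec n}],\Psi,[\Theta]$ infers $\vdash\Upsilon:\Psi,\uparrow\Theta$. A spent context is $\Sigma ::= \Gamma \mid \Sigma,[\downarrow N]$. The lowering operation is $\lfloor\Gamma\rfloor=\Gamma$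 and $\lfloor\Sigma,[\downarrow N]\rfloor=\lfloor\Sigma\rfloor,N$. -}

module Defs where

open import Data.Nat using (ℕ)
open import Data.List using (List; []; _∷_; _++_; [_]; map)
open import Data.List.Relation.Unary.All using (All)
open import Data.List.Membership.Propositional using (_∈_)
open import Data.List.Relation.Binary.Permutation.Propositional using (_↭_)

Atom : Set
Atom = ℕ

mutual
  data Pos : Set where
    atom : Atom → Pos
    𝟙    : Pos
    _⊗_  : Pos → Pos → Pos
    𝟘    : Pos
    _⊕_  : Pos → Pos → Pos
    !_   : Neg → Pos
    ↓_   : Neg → Pos

  data Neg : Set where
    atom⊥ : Atom → Neg
    ⊥'    : Neg
    _⅋_   : Neg → Neg → Neg
    ⊤'    : Neg
    _&_   : Neg → Neg → Neg
    ¿_    : Pos → Neg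
    ↑_    : Pos → Neg

-- Elements of a focusing context Ψ: a negative formula, or a focused positive [P].
data Item : Set where
  neg : Neg → Item
  foc : Pos → Item

-- Multisets are lists; every rule's conclusion is taken up to permutation (_↭_),
-- so contexts are effectively multisets.
-- ⊢ Υ : Γ      is   Υ ⊢ Γ
-- ⊨ Υ : Ψ      is   Υ ⊨ Ψ
mutual
  data _⊢_ (Υ : List Pos) : List Neg → Set where
    ⊥-rule : ∀ {Γ Δ} → Υ ⊢ Γ → Δ ↭ (⊥' ∷ Γ) → Υ ⊢ Δ
    ⅋-rule : ∀ {Γ Δ N M} → Υ ⊢ (N ∷ M ∷ Γ) → Δ ↭ ((N ⅋ M) ∷ Γ) → Υ ⊢ Δ
    ⊤-rule : ∀ {Γ Δ} → Δ ↭ (⊤' ∷ Γ) → Υ ⊢ Δ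
    &-rule : ∀ {Γ Δ N M} → Υ ⊢ (N ∷ Γ) → Υ ⊢ (M ∷ Γ) → Δ ↭ ((N & M) ∷ Γ) → Υ ⊢ Δ
    ?-rule : ∀ {Γ Δ P} → (P ∷ Υ) ⊢ Γ → Δ ↭ ((¿ P) ∷ Γ) → Υ ⊢ Δ
    -- decision: from ⊨ Υ : [Υ^n], Γ, [Θ] infer ⊢ Υ : Γ, ↑Θ.
    -- Υ^n is represented as a list Ξ of (copies of) elements of Υ.
    decide : ∀ {Γ Δ Ξ Θ Ψ} → All (_∈ Υ) Ξ →
             Υ ⊨ Ψ → Ψ ↭ (map foc Ξ ++ map neg Γ ++ map foc Θ) →
             Δ ↭ (Γ ++ map ↑_ Θ) → Υ ⊢ Δ

  data _⊨_ (Υ : List Pos) : List Item → Set where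
    ax-rule : ∀ {Ψ a} → Ψ ↭ (neg (atom⊥ a) ∷ foc (atom a) ∷ []) → Υ ⊨ Ψ
    𝟙-rule  : ∀ {Ψ} → Ψ ↭ [ foc 𝟙 ] → Υ ⊨ Ψ
    ⊗-rule  : ∀ {Ψ Ψ₁ Ψ₂ P Q} → Υ ⊨ (Ψ₁ ++ [ foc P ]) → Υ ⊨ (Ψ₂ ++ [ foc Q ]) →
              Ψ ↭ (Ψ₁ ++ Ψ₂ ++ [ foc (P ⊗ Q) ]) → Υ ⊨ Ψ
    ⊕L-rule : ∀ {Ψ Ψ' P Q} → Υ ⊨ (Ψ' ++ [ foc P ]) → Ψ ↭ (Ψ' ++ [ foc (P ⊕ Q) ]) → Υ ⊨ Ψ
    ⊕R-rule : ∀ {Ψ Ψ' P Q} → Υ ⊨ (Ψ' ++ [ foc Q ]) → Ψ ↭ (Ψ' ++ [ foc (P ⊕ Q) ]) → Υ ⊨ Ψ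
    !-rule  : ∀ {Ψ N} → Υ ⊢ [ N ] → Ψ ↭ [ foc (! N) ] → Υ ⊨ Ψ
    -- ↓: from ⊢ Υ : Γ, Δ infer ⊨ Υ : Γ, [↓Δ]   (Δ non-empty)
    ↓-rule  : ∀ {Ψ Γ N Δ} → Υ ⊢ (Γ ++ N ∷ Δ) →
              Ψ ↭ (map neg Γ ++ map (λ M → foc (↓ M)) (N ∷ Δ)) → Υ ⊨ Ψ

data Spent : Set where
  base : List Neg → Spent
  _,↓_ : Spent → Neg → Spent

toCtx : Spent → List Item
toCtx (base Γ)  = map neg Γ
toCtx (Σ ,↓ N)  = toCtx Σ ++ [ foc (↓ N) ]

⌊_⌋ : Spent → List Neg
⌊ base Γ ⌋  = Γ
⌊ Σ ,↓ N ⌋  = ⌊ Σ ⌋ ++ [ N ]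

-- Shapes of derivations: the tree of rule names (formulas and permutations erased).
data RuleName : Set where
  r⊥ r⅋ r⊤ r& r? rdecide rax r𝟙 r⊗ r⊕L r⊕R r! r↓ : RuleName

data Shape : Set where
  node : RuleName → List Shape → Shape

mutual
  shape⊢ : ∀ {Υ Γ} → Υ ⊢ Γ → Shape
  shape⊢ (⊥-rule d _)       = node r⊥ [ shape⊢ d ]
  shape⊢ (⅋-rule d _)       = node r⅋ [ shape⊢ d ]
  shape⊢ (⊤-rule _)         = node r⊤ []
  shape⊢ (&-rule d e _)     = node r& (shape⊢ d ∷ shape⊢ e ∷ [])
  shape⊢ (?-rule d _)       = node r? [ shape⊢ d ]
  shape⊢ (decide _ d _ _)   = node rdecide [ shape⊨ d ]

  shape⊨ : ∀ {Υ Ψ} → Υ ⊨ Ψ → Shape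
  shape⊨ (ax-rule _)        = node rax []
  shape⊨ (𝟙-rule _)         = node r𝟙 []
  shape⊨ (⊗-rule d e _)     = node r⊗ (shape⊨ d ∷ shape⊨ e ∷ [])
  shape⊨ (⊕L-rule d _)      = node r⊕L [ shape⊨ d ]
  shape⊨ (⊕R-rule d _)      = node r⊕R [ shape⊨ d ]
  shape⊨ (!-rule d _)       = node r! [ shape⊢ d ]
  shape⊨ (↓-rule d _)       = node r↓ [ shape⊢ d ]

module Submission where

-- Generalise Σ to any context Φ of *spent items*, i.e. negative formulas or
-- blurred foci [↓N]; lowering Φ replaces every item by its underlying negative
-- formula ('blur').  Since Φ holds no focus other than [↓N]'s, the last rule is either
--   * a positive rule (axiom, 1, ⊗, ⊕, !) whose principal focus is not a [↓N],
--     hence must be [P] itself: the rest of its conclusion is a permutation of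
--     Φ, and we re-apply the same rule to the lowered (sub)derivations; or
--   * the ↓ rule: then P = ↓M, and after lowering Φ the single remaining focus
--     [↓M] is blurred by the ↓ rule from the same premise, up to exchange.

open import Defs
open import Data.List using (List; []; _∷_; _++_; [_]; map)
open import Data.List.Properties using (++-identityʳ; ++-assoc; map-++; map-∘; map-id)
open import Data.List.Relation.Unary.All using (All; []; _∷_; lookup; universal)
open import Data.List.Relation.Unary.All.Properties as AllP using (++⁻ˡ; ++⁻ʳ)
open import Data.List.Relation.Unary.Any using (here)
open import Data.List.Membership.Propositional using (_∈_)
open import Data.List.Membership.Propositional.Properties using (∈-++⁻; ∈-++⁺ʳ; ∈-map⁻)
open import Data.List.Relation.Binary.Permutation.Propositional
  using (_↭_; ↭-refl; ↭-sym; ↭-trans; ↭-reflexive)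
open import Data.List.Relation.Binary.Permutation.Propositional.Properties
  using (∈-resp-↭; All-resp-↭; drop-mid; ++⁺ʳ)
  renaming (map⁺ to ↭-map⁺)
open import Data.Product using (Σ-syntax; ∃-syntax; _,_; _×_)
open import Data.Sum using (inj₁; inj₂)
open import Relation.Nullary using (¬_; contradiction)
open import Relation.Binary.PropositionalEquality
  using (_≡_; refl; sym; trans; cong; cong₂; subst; subst₂)

data SpentItem : Item → Set where
  spent-neg  : ∀ {N} → SpentItem (neg N)
  spent-down : ∀ {N} → SpentItem (foc (↓ N))

-- The negative formula underlying an item; on spent items this is lowering.
-- (A focus [Q] with Q not a shift never occurs in a spent context; it is sent
-- to ↑Q, the formula it would come from in the inversion phase.)
blur : Item → Neg
blur (neg N)     = N
blur (foc (↓ N)) = N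
blur (foc Q)     = ↑ Q

blur-neg : (Γ : List Neg) → map blur (map neg Γ) ≡ Γ
blur-neg Γ = trans (sym (map-∘ Γ)) (map-id Γ)

blur-down : (Γ : List Neg) → map blur (map (λ M → foc (↓ M)) Γ) ≡ Γ
blur-down Γ = trans (sym (map-∘ Γ)) (map-id Γ)

-- Exchange is strongly admissible for inversion sequents: every rule already
-- concludes up to a permutation, which absorbs the new one.
exchange⊢ : ∀ {Υ Γ Γ′} → (d : Υ ⊢ Γ) → Γ′ ↭ Γ →
            Σ[ d′ ∈ Υ ⊢ Γ′ ] shape⊢ d′ ≡ shape⊢ d
exchange⊢ (⊥-rule d p) q = ⊥-rule d (↭-trans q p) , refl
exchange⊢ (⅋-rule d p) q = ⅋-rule d (↭-trans q p) , refl
exchange⊢ (⊤-rule p) q = ⊤-rule (↭-trans q p) , refl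
exchange⊢ (&-rule d e p) q = &-rule d e (↭-trans q p) , refl
exchange⊢ (?-rule d p) q = ?-rule d (↭-trans q p) , refl
exchange⊢ (decide {Γ = Γ} {Ξ = Ξ} {Θ = Θ} a d r p) q =
  decide {Γ = Γ} {Ξ = Ξ} {Θ = Θ} a d r (↭-trans q p) , refl

-- Applied with y the principal focus of a
-- positive rule and Φ spent, it identifies that focus with [P].
principal-focus : ∀ {Φ S : List Item} {x y} → All SpentItem Φ → ¬ SpentItem y →
                  Φ ++ [ x ] ↭ S ++ [ y ] → x ≡ y × Φ ↭ S
principal-focus {Φ} {S} spent y-not-spent p
  with ∈-++⁻ Φ (∈-resp-↭ (↭-sym p) (∈-++⁺ʳ S (here refl)))
... | inj₁ y∈Φ        = contradiction (lookup spent y∈Φ) y-not-spent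
... | inj₂ (here refl) =
  refl , subst₂ _↭_ (++-identityʳ Φ) (++-identityʳ S) (drop-mid Φ S p)

focus-is-shift : ∀ {Γ L P} → foc P ∈ map neg Γ ++ map (λ M → foc (↓ M)) L →
                 ∃[ M ] P ≡ ↓ M
focus-is-shift {Γ} m with ∈-++⁻ (map neg Γ) m
... | inj₁ m-neg with ∈-map⁻ neg m-neg
...   | _ , _ , ()
focus-is-shift {Γ} m | inj₂ m-down with ∈-map⁻ (λ M → foc (↓ M)) m-down
...   | M , _ , refl = M , refl

lowerCtx : List Item → List Item
lowerCtx Φ = map neg (map blur Φ)

lowerCtx-++ : (A B : List Item) → lowerCtx (A ++ B) ≡ lowerCtx A ++ lowerCtx B
lowerCtx-++ A B = trans (cong (map neg) (map-++ blur A B)) (map-++ neg (map blur A) (map blur B))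

lowerCtx-↭ : ∀ {Φ S : List Item} x → Φ ↭ S → lowerCtx Φ ++ [ x ] ↭ lowerCtx S ++ [ x ]
lowerCtx-↭ x r = ++⁺ʳ [ x ] (↭-map⁺ neg (↭-map⁺ blur r))

blur-shift-premise : ∀ {Φ Γ N Δ M} →
  Φ ++ [ foc (↓ M) ] ↭ map neg Γ ++ map (λ K → foc (↓ K)) (N ∷ Δ) →
  map blur Φ ++ [ M ] ↭ Γ ++ N ∷ Δ
blur-shift-premise {Φ} {Γ} {N} {Δ} {M} q =
  subst₂ _↭_ (map-++ blur Φ [ foc (↓ M) ])
             (trans (map-++ blur (map neg Γ) _) (cong₂ _++_ (blur-neg Γ) (blur-down (N ∷ Δ))))
         (↭-map⁺ blur q)

lower-spent : ∀ {Υ Φ P} → All SpentItem Φ → (d : Υ ⊨ (Φ ++ [ foc P ])) →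
              Σ[ d′ ∈ Υ ⊨ (lowerCtx Φ ++ [ foc P ]) ] shape⊨ d′ ≡ shape⊨ d
lower-spent spent (ax-rule {a = a} q)
  with principal-focus {S = [ neg (atom⊥ a) ]} spent (λ ()) q
... | refl , r = ax-rule (lowerCtx-↭ _ r) , refl
lower-spent spent (𝟙-rule q) with principal-focus {S = []} spent (λ ()) q
... | refl , r = 𝟙-rule (lowerCtx-↭ _ r) , refl
lower-spent spent (!-rule d q) with principal-focus {S = []} spent (λ ()) q
... | refl , r = !-rule d (lowerCtx-↭ _ r) , refl
lower-spent spent (⊕L-rule d q) with principal-focus spent (λ ()) q
... | refl , r with lower-spent (All-resp-↭ r spent) d
...   | d′ , same = ⊕L-rule d′ (lowerCtx-↭ _ r) , cong (λ s → node r⊕L [ s ]) same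
lower-spent spent (⊕R-rule d q) with principal-focus spent (λ ()) q
... | refl , r with lower-spent (All-resp-↭ r spent) d
...   | d′ , same = ⊕R-rule d′ (lowerCtx-↭ _ r) , cong (λ s → node r⊕R [ s ]) same
lower-spent spent (⊗-rule {Ψ₁ = Ψ₁} {Ψ₂} d e q)
  with principal-focus spent (λ ()) (subst (_ ↭_) (sym (++-assoc Ψ₁ Ψ₂ _)) q)
... | refl , r with All-resp-↭ r spent
...   | spent₁₂ with lower-spent (++⁻ˡ Ψ₁ spent₁₂) d | lower-spent (++⁻ʳ Ψ₁ spent₁₂) e
...     | d′ , same₁ | e′ , same₂ =
  ⊗-rule d′ e′ (↭-trans (lowerCtx-↭ _ r)
    (↭-reflexive (trans (cong (_++ _) (lowerCtx-++ Ψ₁ Ψ₂)) (++-assoc (lowerCtx Ψ₁) _ _))))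
  , cong₂ (λ s t → node r⊗ (s ∷ t ∷ [])) same₁ same₂
lower-spent {Φ = Φ} spent (↓-rule {Γ = Γ} {N} {Δ} d q)
  with focus-is-shift {Γ} {N ∷ Δ} (∈-resp-↭ q (∈-++⁺ʳ Φ (here refl)))
... | M , refl with exchange⊢ d (blur-shift-premise q)
...   | d′ , same = ↓-rule {Γ = map blur Φ} {M} {[]} d′ ↭-refl , cong (λ s → node r↓ [ s ]) same

toCtx-spent : (Σ : Spent) → All SpentItem (toCtx Σ)
toCtx-spent (base Γ) = AllP.map⁺ (universal (λ _ → spent-neg) Γ)
toCtx-spent (Σ ,↓ N) = AllP.++⁺ (toCtx-spent Σ) (spent-down ∷ [])

blur-toCtx : (Σ : Spent) → map blur (toCtx Σ) ≡ ⌊ Σ ⌋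
blur-toCtx (base Γ) = blur-neg Γ
blur-toCtx (Σ ,↓ N) = trans (map-++ blur (toCtx Σ) _) (cong (_++ [ N ]) (blur-toCtx Σ))

mainTheorem2 : (Υ : List Pos) (Σ : Spent) (P : Pos) →
    (d : Υ ⊨ (toCtx Σ ++ [ foc P ])) →
    Σ[ d′ ∈ Υ ⊨ (map neg ⌊ Σ ⌋ ++ [ foc P ]) ] shape⊨ d′ ≡ shape⊨ d
mainTheorem2 Υ Σ P d =
  subst (λ Γ → Σ[ d′ ∈ Υ ⊨ (map neg Γ ++ [ foc P ]) ] shape⊨ d′ ≡ shape⊨ d)
        (blur-toCtx Σ)
        (lower-spent (toCtx-spent Σ) d)
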